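{- Let $P$ be an annotated normal form and $\Gamma$ a type environment containing the assignments $a{:}\tau$ and $b{:}\tau$ (same type $\tau$). If $\Gamma\vdash P$ then $\Gamma\vdash P\{b/a\}$, where $P\{b/a\}$ is $P$ with free occurrences of $a$ replaced by $b$.
   Context: \textbf{Syntax.} $\pi$-terms: $P ::= \nu x.P \mid P_1\parallel P_2 \mid M \mid\, !M$, $M ::= \mathbf 0 \mid M+M \mid \pi.P$, $\pi ::= a(x)\mid \overline a\langle b\rangle \mid \tau$; $x$ bound in $\nu x.P$, $a(x).P$; $\mathrm{fn}$ free names; $M$, $!M$ sequential. Types over a finite forest $(\mathcal T,\lessdot)$ of base types ($<,\le$ transitive / reflexive-transitive closures of parent relation): $\tau::=t\mid t[\tau]$, $\mathrm{base}(t)=\mathrm{base}(t[\tau])=t$. Annotated terms have restrictions $\nu(x{:}\tau)$. Normal forms $\nu X.\prod_{i\in I}A_i$: $X$ a set of restrictions (seen as type assignments), each $A_i$ being $\sum_j\pi_j.N_j$ or $!(\sum_j\pi_j.N_j)$ with $N_j$ normal forms, each name bound at most once, free and bound names disjoint. \textbf{Tied-to / migratable.} For $P=\nu X.\prod_{i\in I}A_i$: $i$ linked to $j$ if $\mathrm{fn}(A_i)\cap\mathrm{fn}(A_j)$ contains a name restricted in $X$; tied-to is its transitive closure; a name $y$ is tied to $A_i$ in $P$ if $y\in\mathrm{fn}(A_j)$ for some $j$ tied to $i$; in $a(y).P$, $A_i$ is migratable if $y$ is tied to $A_i$ in $P$. \textbf{Type system.} Environments: finite partial maps names$\to$types; $\Gamma,X$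 extension; $\Gamma(Y)=\{\Gamma(y)\mid y\in Y\cap\mathrm{dom}\Gamma\}$, base elementwise, $S<t$ means $s<t$ for all $s\in S$. Rules on annotated normal forms: (Par) $\Gamma\vdash\nu X.\prod_{i\in I}A_i$ if $\Gamma,X\vdash A_i$ for all $i$ and for all $i$, $(x{:}\tau_x)\in X$ with $x$ tied to $A_i$, $\mathrm{base}(\Gamma(\mathrm{fn}(A_i)))<\mathrm{base}(\tau_x)$; (Choice) $\Gamma\vdash\sum_i\pi_i.P_i$ if each $\Gamma\vdash\pi_i.P_i$; (Repl) $\Gamma\vdash!A$ if $\Gamma\vdash A$; (Tau) $\Gamma\vdash\tau.P$ if $\Gamma\vdash P$; (Out) $\Gamma\vdash\overline a\langle b\rangle.Q$ if $\Gamma(a)=t_a[\tau_b]$, $\Gamma(b)=\tau_b$, $\Gamma\vdash Q$; (In) $\Gamma\vdash a(x).\nu X.\prod_iA_i$ if $\Gamma(a)=t_a[\tau_x]$, $\Gamma,x{:}\tau_x\vdash\nu X.\prod_iA_i$, and either $\mathrm{base}(\tau_x)\le t_a$ or for each migratable $A_i$, $\mathrm{base}(\Gamma(\mathrm{fn}(A_i)\setminus\{a\}))<t_a$. -}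

module Defs where

open import Data.Nat using (ℕ; _≟_; _≡ᵇ_)
open import Data.Bool using (Bool; true; false; if_then_else_; _∨_)
open import Data.Fin using (Fin)
open import Data.Maybe using (Maybe; just; nothing)
open import Data.List using (List; []; _∷_; _++_; map; filter; length; lookup)
open import Data.List.Membership.Propositional using (_∈_; _∉_)
open import Data.List.Relation.Unary.All using (All)
open import Data.List.Relation.Unary.Unique.Propositional using (Unique)
open import Data.Product using (Σ; _×_; _,_; proj₁)
open import Data.Sum using (_⊎_)
open import Relation.Nullary using (¬_; ¬?)
open import Relation.Binary.PropositionalEquality using (_≡_)
open import Relation.Binary.Construct.Closure.Transitive using (TransClosure)
open import Relation.Binary.Construct.Closure.ReflexiveTransitive using (Star)

Name : Set
Name = ℕ

-- Finite forest of base types: base types are Fin n, each with at most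
-- one parent; the parent relation must be acyclic.

Parent : ℕ → Set
Parent n = Fin n → Maybe (Fin n)

_⋖[_]_ : {n : ℕ} → Fin n → Parent n → Fin n → Set
p ⋖[ par ] c = par c ≡ just p

_<[_]_ : {n : ℕ} → Fin n → Parent n → Fin n → Set
s <[ par ] t = TransClosure (λ p c → p ⋖[ par ] c) s t

_≤[_]_ : {n : ℕ} → Fin n → Parent n → Fin n → Set
s ≤[ par ] t = Star (λ p c → p ⋖[ par ] c) s t

record Forest : Set where
  field
    n       : ℕ
    parent  : Parent n
    acyclic : ∀ t → ¬ (t <[ parent ] t)

-- Types  τ ::= t | t[τ]

data Ty (n : ℕ) : Set where
  base : Fin n → Ty n
  chan : Fin n → Ty n → Ty n

baseOf : {n : ℕ} → Ty n → Fin n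
baseOf (base t)   = t
baseOf (chan t _) = t

-- Annotated normal forms  ν X. ∏_{i∈I} A_i
--   A ::= Σ_j π_j.N_j  |  !(Σ_j π_j.N_j)

mutual
  data NF (n : ℕ) : Set where
    ν_∙_ : List (Name × Ty n) → List (Agent n) → NF n

  data Agent (n : ℕ) : Set where
    sum  : List (Pre n) → Agent n
    repl : List (Pre n) → Agent n

  data Pre (n : ℕ) : Set where
    inp : Name → Name → NF n → Pre n
    out : Name → Name → NF n → Pre n
    tau : NF n → Pre n

dom : {n : ℕ} → List (Name × Ty n) → List Name
dom = map proj₁

remove : Name → List Name → List Name
remove x = filter (λ y → ¬? (y ≟ x))

removeAll : List Name → List Name → List Name
removeAll []       ys = ys
removeAll (x ∷ xs) ys = remove x (removeAll xs ys)

mutual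
  fnNF : {n : ℕ} → NF n → List Name
  fnNF (ν X ∙ As) = removeAll (dom X) (fnAgs As)

  fnAgs : {n : ℕ} → List (Agent n) → List Name
  fnAgs []       = []
  fnAgs (A ∷ As) = fnAg A ++ fnAgs As

  fnAg : {n : ℕ} → Agent n → List Name
  fnAg (sum ps)  = fnPres ps
  fnAg (repl ps) = fnPres ps

  fnPres : {n : ℕ} → List (Pre n) → List Name
  fnPres []       = []
  fnPres (p ∷ ps) = fnPre p ++ fnPres ps

  fnPre : {n : ℕ} → Pre n → List Name
  fnPre (inp a x P) = a ∷ remove x (fnNF P)
  fnPre (out a b P) = a ∷ b ∷ fnNF P
  fnPre (tau P)     = fnNF P

-- bound names, listed with multiplicity (one entry per binder)
mutual
  bnNF : {n : ℕ} → NF n → List Name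
  bnNF (ν X ∙ As) = dom X ++ bnAgs As

  bnAgs : {n : ℕ} → List (Agent n) → List Name
  bnAgs []       = []
  bnAgs (A ∷ As) = bnAg A ++ bnAgs As

  bnAg : {n : ℕ} → Agent n → List Name
  bnAg (sum ps)  = bnPres ps
  bnAg (repl ps) = bnPres ps

  bnPres : {n : ℕ} → List (Pre n) → List Name
  bnPres []       = []
  bnPres (p ∷ ps) = bnPre p ++ bnPres ps

  bnPre : {n : ℕ} → Pre n → List Name
  bnPre (inp a x P) = x ∷ bnNF P
  bnPre (out a b P) = bnNF P
  bnPre (tau P)     = bnNF P

IsNormalForm : {n : ℕ} → NF n → Set
IsNormalForm P = Unique (bnNF P) × (∀ x → x ∈ fnNF P → x ∉ bnNF P)

memberᵇ : Name → List Name → Bool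
memberᵇ x []       = false
memberᵇ x (y ∷ ys) = (x ≡ᵇ y) ∨ memberᵇ x ys

rn : Name → Name → Name → Name
rn a b c = if c ≡ᵇ a then b else c

mutual
  substNF : {n : ℕ} → Name → Name → NF n → NF n
  substNF a b (ν X ∙ As) =
    if memberᵇ a (dom X) then ν X ∙ As else ν X ∙ substAgs a b As

  substAgs : {n : ℕ} → Name → Name → List (Agent n) → List (Agent n)
  substAgs a b []       = []
  substAgs a b (A ∷ As) = substAg a b A ∷ substAgs a b As

  substAg : {n : ℕ} → Name → Name → Agent n → Agent n
  substAg a b (sum ps)  = sum (substPres a b ps)
  substAg a b (repl ps) = repl (substPres a b ps)

  substPres : {n : ℕ} → Name → Name → List (Pre n) → List (Pre n)
  substPres a b []       = []
  substPres a b (p ∷ ps) = substPre a b p ∷ substPres a b ps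

  substPre : {n : ℕ} → Name → Name → Pre n → Pre n
  substPre a b (inp c x P) =
    inp (rn a b c) x (if x ≡ᵇ a then P else substNF a b P)
  substPre a b (out c d P) = out (rn a b c) (rn a b d) (substNF a b P)
  substPre a b (tau P)     = tau (substNF a b P)

-- Type environments (finite partial maps, as association lists;
-- lookup takes the most recent binding).  Γ,X is  X ++ Γ.

Env : ℕ → Set
Env n = List (Name × Ty n)

lookupE : {n : ℕ} → Env n → Name → Maybe (Ty n)
lookupE []            y = nothing
lookupE ((x , τ) ∷ Γ) y = if y ≡ᵇ x then just τ else lookupE Γ y

BaseBelow : {n : ℕ} → Parent n → Env n → List Name → Fin n → Set
BaseBelow par Γ Ys t =
  ∀ y σ → y ∈ Ys → lookupE Γ y ≡ just σ → baseOf σ <[ par ] t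

Linked : {n : ℕ} (X : List (Name × Ty n)) (As : List (Agent n)) →
         Fin (length As) → Fin (length As) → Set
Linked X As i j =
  Σ Name λ z → z ∈ dom X × z ∈ fnAg (lookup As i) × z ∈ fnAg (lookup As j)

TiedTo : {n : ℕ} (X : List (Name × Ty n)) (As : List (Agent n)) →
         Fin (length As) → Fin (length As) → Set
TiedTo X As = TransClosure (Linked X As)

NameTiedTo : {n : ℕ} (X : List (Name × Ty n)) (As : List (Agent n)) →
             Name → Fin (length As) → Set
NameTiedTo X As y i =
  Σ (Fin (length As)) λ j → TiedTo X As j i × y ∈ fnAg (lookup As j)

module _ (F : Forest) where
  open Forest F

  mutual
    data _⊢NF_ (Γ : Env n) : NF n → Set where
      Par : ∀ {X As} →
            (∀ i → (X ++ Γ) ⊢A lookup As i) →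
            (∀ i x τx → (x , τx) ∈ X → NameTiedTo X As x i →
               BaseBelow parent Γ (fnAg (lookup As i)) (baseOf τx)) →
            Γ ⊢NF (ν X ∙ As)

    data _⊢A_ (Γ : Env n) : Agent n → Set where
      Choice : ∀ {ps} → All (Γ ⊢P_) ps → Γ ⊢A sum ps
      Repl   : ∀ {ps} → All (Γ ⊢P_) ps → Γ ⊢A repl ps

    data _⊢P_ (Γ : Env n) : Pre n → Set where
      Tau : ∀ {P} → Γ ⊢NF P → Γ ⊢P tau P
      Out : ∀ {a b Q ta τb} →
            lookupE Γ a ≡ just (chan ta τb) →
            lookupE Γ b ≡ just τb →
            Γ ⊢NF Q →
            Γ ⊢P out a b Q
      In  : ∀ {a x X As ta τx} →
            lookupE Γ a ≡ just (chan ta τx) →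
            ((x , τx) ∷ Γ) ⊢NF (ν X ∙ As) →
            (baseOf τx ≤[ parent ] ta
              ⊎ (∀ i → NameTiedTo X As x i →
                   BaseBelow parent Γ (remove a (fnAg (lookup As i))) ta)) →
            Γ ⊢P inp a x (ν X ∙ As)

-- Substitution stops at the binders of a.  If a is bound in P, it is not free
-- in P (P is a normal form), so P{b/a} = P.  Otherwise neither a nor b is bound
-- anywhere in P: the substitution renames the free occurrences of a and
-- captures nothing, so every free name of a component of P{b/a} is the image
-- under a ↦ b of a free name of the corresponding component of P.  As a and b
-- have the same type, every lookup and every base-type bound transfers.  The
-- tied-to relation transfers backwards because components are linked through
-- restricted names, which are never b and so are untouched by the renaming.
module Submission where

open import Defs
open import Data.Bool using (true; false)
open import Data.Empty using (⊥-elim)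
open import Data.Fin using (Fin; zero; suc)
open import Data.List using (List; []; _∷_; _++_; map; length; lookup)
open import Data.List.Properties using (map-++)
open import Data.List.Membership.Propositional using (_∈_; _∉_)
open import Data.List.Membership.Propositional.Properties
  using (∈-++⁺ˡ; ∈-++⁺ʳ; ∈-filter⁺; ∈-filter⁻; ∈-map⁺; ∈-map⁻)
open import Data.List.Relation.Binary.Subset.Propositional using (_⊆_)
open import Data.List.Relation.Binary.Subset.Propositional.Properties
  using (⊆-trans; ++⁺; ∷⁺ʳ; filter⁺′)
open import Data.List.Relation.Unary.All using (All; []; _∷_)
open import Data.List.Relation.Unary.Any using (here; there)
open import Data.Maybe using (just)
open import Data.Nat using (ℕ; _≟_; _≡ᵇ_)
open import Data.List.Membership.DecPropositional _≟_ using (_∈?_)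
open import Data.Nat.Properties using (≡ᵇ⇒≡; ≡⇒≡ᵇ)
open import Data.Product using (_×_; _,_; proj₁)
open import Data.Sum using (map₂)
open import Function using (id; _∘_; _$_)
open import Relation.Nullary using (yes; no; ¬?)
open import Relation.Nullary.Reflects using (Reflects; ofʸ; ofⁿ; fromEquivalence)
open import Relation.Binary.PropositionalEquality
open import Relation.Binary.Construct.Closure.Transitive using ([_]; _∷_)

≡ᵇ-reflects : ∀ m n → Reflects (m ≡ n) (m ≡ᵇ n)
≡ᵇ-reflects m n = fromEquivalence (≡ᵇ⇒≡ m n) (≡⇒≡ᵇ m n)

memberᵇ-reflects : ∀ x ys → Reflects (x ∈ ys) (memberᵇ x ys)
memberᵇ-reflects x [] = ofⁿ λ ()
memberᵇ-reflects x (y ∷ ys)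
  with x ≡ᵇ y | ≡ᵇ-reflects x y | memberᵇ x ys | memberᵇ-reflects x ys
... | true  | ofʸ x≡y | _     | _        = ofʸ (here x≡y)
... | false | ofⁿ _   | true  | ofʸ x∈ys = ofʸ (there x∈ys)
... | false | ofⁿ x≢y | false | ofⁿ x∉ys =
  ofⁿ λ { (here x≡y) → x≢y x≡y ; (there x∈ys) → x∉ys x∈ys }

∉-++⁻ˡ : ∀ {A : Set} {x : A} xs {ys} → x ∉ xs ++ ys → x ∉ xs
∉-++⁻ˡ xs x∉ = x∉ ∘ ∈-++⁺ˡ

∉-++⁻ʳ : ∀ {A : Set} {x : A} xs {ys} → x ∉ xs ++ ys → x ∉ ys
∉-++⁻ʳ xs x∉ = x∉ ∘ ∈-++⁺ʳ xs

map-++⁺ : ∀ {A B : Set} (f : A → B) {ws ys} xs zs →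
          ws ⊆ map f xs → ys ⊆ map f zs → ws ++ ys ⊆ map f (xs ++ zs)
map-++⁺ f xs zs ws⊆ ys⊆ = subst (_ ⊆_) (sym (map-++ f xs zs)) (++⁺ ws⊆ ys⊆)

∈-remove⁺ : ∀ {x y ys} → y ∈ ys → y ≢ x → y ∈ remove x ys
∈-remove⁺ {x} = ∈-filter⁺ (λ y → ¬? (y ≟ x))

remove⁺ : ∀ x {ys zs} → ys ⊆ zs → remove x ys ⊆ remove x zs
remove⁺ x = filter⁺′ (λ y → ¬? (y ≟ x)) (λ y → ¬? (y ≟ x)) id

remove-map : ∀ (f : Name → Name) x ys → remove (f x) (map f ys) ⊆ map f (remove x ys)
remove-map f x ys y∈ with ∈-filter⁻ (λ y → ¬? (y ≟ f x)) {xs = map f ys} y∈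
... | y∈fys , y≢fx with ∈-map⁻ f y∈fys
... | z , z∈ys , refl = ∈-map⁺ f (∈-remove⁺ z∈ys λ { refl → y≢fx refl })

remove-map-fixed : ∀ (f : Name → Name) {x} ys → f x ≡ x →
                   remove x (map f ys) ⊆ map f (remove x ys)
remove-map-fixed f {x} ys fx≡x =
  subst (λ z → remove z (map f ys) ⊆ map f (remove x ys)) fx≡x (remove-map f x ys)

∈-removeAll⁺ : ∀ xs {y ys} → y ∈ ys → y ∉ xs → y ∈ removeAll xs ys
∈-removeAll⁺ []       y∈ _  = y∈
∈-removeAll⁺ (x ∷ xs) y∈ y∉ = ∈-remove⁺ (∈-removeAll⁺ xs y∈ (y∉ ∘ there)) (y∉ ∘ here)

removeAll⁺ : ∀ xs {ys zs} → ys ⊆ zs → removeAll xs ys ⊆ removeAll xs zs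
removeAll⁺ []       = id
removeAll⁺ (x ∷ xs) = remove⁺ x ∘ removeAll⁺ xs

removeAll-map-fixed : ∀ (f : Name → Name) xs ys → (∀ {x} → x ∈ xs → f x ≡ x) →
                      removeAll xs (map f ys) ⊆ map f (removeAll xs ys)
removeAll-map-fixed f []       ys fixed = id
removeAll-map-fixed f (x ∷ xs) ys fixed =
  ⊆-trans (remove⁺ x (removeAll-map-fixed f xs ys (fixed ∘ there)))
          (remove-map-fixed f (removeAll xs ys) (fixed (here refl)))

lookupE-++-∉ : ∀ {n} (X : List (Name × Ty n)) {Δ y} → y ∉ dom X →
               lookupE (X ++ Δ) y ≡ lookupE Δ y
lookupE-++-∉ []            y∉ = refl
lookupE-++-∉ ((x , σ) ∷ X) {y = y} y∉ with y ≡ᵇ x | ≡ᵇ-reflects y x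
... | true  | ofʸ y≡x = ⊥-elim (y∉ (here y≡x))
... | false | ofⁿ _   = lookupE-++-∉ X (y∉ ∘ there)

module Renaming (a b : Name) where

  -- A record rather than an equation so that Δ can be inferred from the type.
  record SameType {n} (Δ : Env n) : Set where
    constructor sameType
    field lookupE-a≡b : lookupE Δ a ≡ lookupE Δ b

  open SameType

  SameType-++ : ∀ {n} (X : List (Name × Ty n)) {Δ} → a ∉ dom X → b ∉ dom X →
                SameType Δ → SameType (X ++ Δ)
  SameType-++ X a∉ b∉ same = sameType $
    trans (lookupE-++-∉ X a∉) (trans (lookupE-a≡b same) (sym (lookupE-++-∉ X b∉)))

  rn-self : rn a b a ≡ b
  rn-self with a ≡ᵇ a | ≡ᵇ-reflects a a
  ... | true  | _       = refl
  ... | false | ofⁿ a≢a = ⊥-elim (a≢a refl)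

  rn-≢ : ∀ {c} → c ≢ a → rn a b c ≡ c
  rn-≢ {c} c≢a with c ≡ᵇ a | ≡ᵇ-reflects c a
  ... | true  | ofʸ c≡a = ⊥-elim (c≢a c≡a)
  ... | false | _       = refl

  ∈-map-rn⁻ : ∀ {z ys} → z ∈ map (rn a b) ys → z ≢ b → z ∈ ys
  ∈-map-rn⁻ z∈ z≢b with ∈-map⁻ (rn a b) z∈
  ... | c , c∈ys , refl with c ≟ a
  ...   | yes refl = ⊥-elim (z≢b rn-self)
  ...   | no c≢a   = subst (_∈ _) (sym (rn-≢ c≢a)) c∈ys

  lookupE-rn : ∀ {n} {Δ : Env n} → SameType Δ → ∀ c → lookupE Δ (rn a b c) ≡ lookupE Δ c
  lookupE-rn {Δ = Δ} same c with c ≟ a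
  ... | yes refl = trans (cong (lookupE Δ) rn-self) (sym (lookupE-a≡b same))
  ... | no c≢a   = cong (lookupE Δ) (rn-≢ c≢a)

  BaseBelow-renamed : ∀ {n par} {Δ : Env n} {ys zs t} → SameType Δ →
                      ys ⊆ map (rn a b) zs → BaseBelow par Δ zs t → BaseBelow par Δ ys t
  BaseBelow-renamed same ys⊆ below y σ y∈ys Δy with ∈-map⁻ (rn a b) (ys⊆ y∈ys)
  ... | z , z∈zs , refl = below z σ z∈zs (trans (sym (lookupE-rn same z)) Δy)

  module _ {n : ℕ} where

    substNF-ν : (X : List (Name × Ty n)) (As : List (Agent n)) → a ∉ dom X →
                substNF a b (ν X ∙ As) ≡ ν X ∙ substAgs a b As
    substNF-ν X As a∉X with memberᵇ a (dom X) | memberᵇ-reflects a (dom X)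
    ... | true  | ofʸ a∈X = ⊥-elim (a∉X a∈X)
    ... | false | _       = refl

    substPre-inp : ∀ c x (P : NF n) → x ≢ a →
                   substPre a b (inp c x P) ≡ inp (rn a b c) x (substNF a b P)
    substPre-inp c x P x≢a with x ≡ᵇ a | ≡ᵇ-reflects x a
    ... | true  | ofʸ x≡a = ⊥-elim (x≢a x≡a)
    ... | false | _       = refl

    mutual
      substNF-fresh : (P : NF n) → a ∉ fnNF P → substNF a b P ≡ P
      substNF-fresh (ν X ∙ As) a∉ with memberᵇ a (dom X) | memberᵇ-reflects a (dom X)
      ... | true  | _        = refl
      ... | false | ofⁿ a∉X  =
        cong (ν X ∙_) (substAgs-fresh As (a∉ ∘ λ a∈ → ∈-removeAll⁺ (dom X) a∈ a∉X))

      substAgs-fresh : (As : List (Agent n)) → a ∉ fnAgs As → substAgs a b As ≡ As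
      substAgs-fresh []       _  = refl
      substAgs-fresh (A ∷ As) a∉ =
        cong₂ _∷_ (substAg-fresh A (∉-++⁻ˡ (fnAg A) a∉))
                  (substAgs-fresh As (∉-++⁻ʳ (fnAg A) a∉))

      substAg-fresh : (A : Agent n) → a ∉ fnAg A → substAg a b A ≡ A
      substAg-fresh (sum ps)  a∉ = cong sum (substPres-fresh ps a∉)
      substAg-fresh (repl ps) a∉ = cong repl (substPres-fresh ps a∉)

      substPres-fresh : (ps : List (Pre n)) → a ∉ fnPres ps → substPres a b ps ≡ ps
      substPres-fresh []       _  = refl
      substPres-fresh (p ∷ ps) a∉ =
        cong₂ _∷_ (substPre-fresh p (∉-++⁻ˡ (fnPre p) a∉))
                  (substPres-fresh ps (∉-++⁻ʳ (fnPre p) a∉))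

      substPre-fresh : (p : Pre n) → a ∉ fnPre p → substPre a b p ≡ p
      substPre-fresh (inp c x P) a∉ with x ≡ᵇ a | ≡ᵇ-reflects x a
      ... | true  | _       = cong (λ c′ → inp c′ x P) (rn-≢ λ { refl → a∉ (here refl) })
      ... | false | ofⁿ x≢a =
        cong₂ (λ c′ Q → inp c′ x Q) (rn-≢ λ { refl → a∉ (here refl) })
              (substNF-fresh P λ a∈ → a∉ (there (∈-remove⁺ a∈ (x≢a ∘ sym))))
      substPre-fresh (out c d P) a∉ =
        out-cong (rn-≢ λ { refl → a∉ (here refl) }) (rn-≢ λ { refl → a∉ (there (here refl)) })
              (substNF-fresh P (a∉ ∘ there ∘ there))
        where
          out-cong : ∀ {c′ d′ Q} → c′ ≡ c → d′ ≡ d → Q ≡ P → out c′ d′ Q ≡ out c d P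
          out-cong refl refl refl = refl
      substPre-fresh (tau P) a∉ = cong tau (substNF-fresh P a∉)

    mutual
      fnNF-substNF : (P : NF n) → a ∉ bnNF P → fnNF (substNF a b P) ⊆ map (rn a b) (fnNF P)
      fnNF-substNF (ν X ∙ As) a∉ rewrite substNF-ν X As (∉-++⁻ˡ (dom X) a∉) =
        ⊆-trans (removeAll⁺ (dom X) (fnAgs-substAgs As (∉-++⁻ʳ (dom X) a∉)))
                (removeAll-map-fixed (rn a b) (dom X) (fnAgs As)
                   λ x∈X → rn-≢ λ { refl → ∉-++⁻ˡ (dom X) a∉ x∈X })

      fnAgs-substAgs : (As : List (Agent n)) → a ∉ bnAgs As →
                       fnAgs (substAgs a b As) ⊆ map (rn a b) (fnAgs As)
      fnAgs-substAgs []       _  = id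
      fnAgs-substAgs (A ∷ As) a∉ =
        map-++⁺ (rn a b) (fnAg A) (fnAgs As)
          (fnAg-substAg A (∉-++⁻ˡ (bnAg A) a∉)) (fnAgs-substAgs As (∉-++⁻ʳ (bnAg A) a∉))

      fnAg-substAg : (A : Agent n) → a ∉ bnAg A → fnAg (substAg a b A) ⊆ map (rn a b) (fnAg A)
      fnAg-substAg (sum ps)  = fnPres-substPres ps
      fnAg-substAg (repl ps) = fnPres-substPres ps

      fnPres-substPres : (ps : List (Pre n)) → a ∉ bnPres ps →
                         fnPres (substPres a b ps) ⊆ map (rn a b) (fnPres ps)
      fnPres-substPres []       _  = id
      fnPres-substPres (p ∷ ps) a∉ =
        map-++⁺ (rn a b) (fnPre p) (fnPres ps)
          (fnPre-substPre p (∉-++⁻ˡ (bnPre p) a∉)) (fnPres-substPres ps (∉-++⁻ʳ (bnPre p) a∉))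

      fnPre-substPre : (p : Pre n) → a ∉ bnPre p → fnPre (substPre a b p) ⊆ map (rn a b) (fnPre p)
      fnPre-substPre (inp c x P) a∉ =
        subst (λ q → fnPre q ⊆ map (rn a b) (fnPre (inp c x P)))
              (sym (substPre-inp c x P (a∉ ∘ here ∘ sym))) $
        ∷⁺ʳ (rn a b c) (⊆-trans (remove⁺ x (fnNF-substNF P (a∉ ∘ there)))
                                (remove-map-fixed (rn a b) (fnNF P) (rn-≢ (a∉ ∘ here ∘ sym))))
      fnPre-substPre (out c d P) a∉ = ∷⁺ʳ (rn a b c) (∷⁺ʳ (rn a b d) (fnNF-substNF P a∉))
      fnPre-substPre (tau P)     a∉ = fnNF-substNF P a∉

    -- substAgs preserves length only propositionally, so indices are transported explicitly.
    origin : (As : List (Agent n)) → Fin (length (substAgs a b As)) → Fin (length As)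
    origin (A ∷ As) zero    = zero
    origin (A ∷ As) (suc i) = suc (origin As i)

    lookup-substAgs : (As : List (Agent n)) (i : Fin (length (substAgs a b As))) →
                      lookup (substAgs a b As) i ≡ substAg a b (lookup As (origin As i))
    lookup-substAgs (A ∷ As) zero    = refl
    lookup-substAgs (A ∷ As) (suc i) = lookup-substAgs As i

    bnAg-lookup⊆bnAgs : (As : List (Agent n)) (i : Fin (length As)) → bnAg (lookup As i) ⊆ bnAgs As
    bnAg-lookup⊆bnAgs (A ∷ As) zero    = ∈-++⁺ˡ
    bnAg-lookup⊆bnAgs (A ∷ As) (suc i) = ∈-++⁺ʳ (bnAg A) ∘ bnAg-lookup⊆bnAgs As i

    fnAg-lookup-substAgs : (As : List (Agent n)) → a ∉ bnAgs As →
                           (i : Fin (length (substAgs a b As))) →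
                           fnAg (lookup (substAgs a b As) i)
                             ⊆ map (rn a b) (fnAg (lookup As (origin As i)))
    fnAg-lookup-substAgs As a∉ i rewrite lookup-substAgs As i =
      fnAg-substAg (lookup As (origin As i)) (a∉ ∘ bnAg-lookup⊆bnAgs As (origin As i))

    module _ (X : List (Name × Ty n)) (As : List (Agent n))
             (a∉As : a ∉ bnAgs As) (b∉X : b ∉ dom X) where

      linked-substAgs : ∀ {i j} → Linked X (substAgs a b As) i j →
                        Linked X As (origin As i) (origin As j)
      linked-substAgs {i} {j} (z , z∈X , z∈i , z∈j) = z , z∈X , untouched i z∈i , untouched j z∈j
        where
          untouched : ∀ k → z ∈ fnAg (lookup (substAgs a b As) k) → z ∈ fnAg (lookup As (origin As k))
          untouched k z∈ = ∈-map-rn⁻ (fnAg-lookup-substAgs As a∉As k z∈) λ { refl → b∉X z∈X }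

      tiedTo-substAgs : ∀ {i j} → TiedTo X (substAgs a b As) i j →
                        TiedTo X As (origin As i) (origin As j)
      tiedTo-substAgs [ i~j ]      = [ linked-substAgs i~j ]
      tiedTo-substAgs (i~j ∷ j~⁺k) = linked-substAgs i~j ∷ tiedTo-substAgs j~⁺k

      nameTiedTo-substAgs : ∀ {y i} → y ≢ b →
                            NameTiedTo X (substAgs a b As) y i → NameTiedTo X As y (origin As i)
      nameTiedTo-substAgs y≢b (j , j~⁺i , y∈j) =
        origin As j , tiedTo-substAgs j~⁺i , ∈-map-rn⁻ (fnAg-lookup-substAgs As a∉As j y∈j) y≢b

module Typing (F : Forest) (a b : Name) where
  open Forest F
  open Renaming a b

  migratable-substAgs : ∀ {Δ x X ta} c (As : List (Agent n)) → SameType Δ →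
                        a ∉ bnAgs As → b ∉ dom X → x ≢ b →
                        (∀ i → NameTiedTo X As x i →
                           BaseBelow parent Δ (remove c (fnAg (lookup As i))) ta) →
                        (∀ i → NameTiedTo X (substAgs a b As) x i →
                           BaseBelow parent Δ
                             (remove (rn a b c) (fnAg (lookup (substAgs a b As) i))) ta)
  migratable-substAgs {x = x} {X} c As same a∉As b∉X x≢b migr i x~i =
    BaseBelow-renamed same
      (⊆-trans (remove⁺ (rn a b c) (fnAg-lookup-substAgs As a∉As i))
               (remove-map (rn a b) c (fnAg (lookup As (origin As i)))))
      (migr (origin As i) (nameTiedTo-substAgs X As a∉As b∉X x≢b x~i))

  mutual
    ⊢NF-substNF : ∀ {Δ} (P : NF n) → SameType Δ → a ∉ bnNF P → b ∉ bnNF P →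
                  _⊢NF_ F Δ P → _⊢NF_ F Δ (substNF a b P)
    ⊢NF-substNF (ν X ∙ As) same a∉ b∉ ⊢P rewrite substNF-ν X As (∉-++⁻ˡ (dom X) a∉) =
      ⊢ν-substAgs X As same a∉ b∉ ⊢P

    ⊢ν-substAgs : ∀ {Δ} X (As : List (Agent n)) → SameType Δ →
                  a ∉ dom X ++ bnAgs As → b ∉ dom X ++ bnAgs As →
                  _⊢NF_ F Δ (ν X ∙ As) → _⊢NF_ F Δ (ν X ∙ substAgs a b As)
    ⊢ν-substAgs {Δ} X As same a∉ b∉ (Par ⊢As side) =
      Par (⊢Ags-substAgs As (SameType-++ X a∉X b∉X same) a∉As b∉As ⊢As) side′
      where
        a∉X = ∉-++⁻ˡ (dom X) a∉
        b∉X = ∉-++⁻ˡ (dom X) b∉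
        a∉As = ∉-++⁻ʳ (dom X) a∉
        b∉As = ∉-++⁻ʳ (dom X) b∉

        side′ : ∀ i x τx → (x , τx) ∈ X → NameTiedTo X (substAgs a b As) x i →
                BaseBelow parent Δ (fnAg (lookup (substAgs a b As) i)) (baseOf τx)
        side′ i x τx x∈X x~i =
          BaseBelow-renamed same (fnAg-lookup-substAgs As a∉As i)
            (side (origin As i) x τx x∈X (nameTiedTo-substAgs X As a∉As b∉X x≢b x~i))
          where
            x≢b : x ≢ b
            x≢b refl = b∉X (∈-map⁺ proj₁ x∈X)

    ⊢Ags-substAgs : ∀ {Δ} (As : List (Agent n)) → SameType Δ → a ∉ bnAgs As → b ∉ bnAgs As →
                    (∀ i → _⊢A_ F Δ (lookup As i)) → ∀ i → _⊢A_ F Δ (lookup (substAgs a b As) i)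
    ⊢Ags-substAgs (A ∷ As) same a∉ b∉ ⊢As zero =
      ⊢A-substAg A same (∉-++⁻ˡ (bnAg A) a∉) (∉-++⁻ˡ (bnAg A) b∉) (⊢As zero)
    ⊢Ags-substAgs (A ∷ As) same a∉ b∉ ⊢As (suc i) =
      ⊢Ags-substAgs As same (∉-++⁻ʳ (bnAg A) a∉) (∉-++⁻ʳ (bnAg A) b∉) (⊢As ∘ suc) i

    ⊢A-substAg : ∀ {Δ} (A : Agent n) → SameType Δ → a ∉ bnAg A → b ∉ bnAg A →
                 _⊢A_ F Δ A → _⊢A_ F Δ (substAg a b A)
    ⊢A-substAg (sum ps)  same a∉ b∉ (Choice ⊢ps) = Choice (⊢Pres-substPres ps same a∉ b∉ ⊢ps)
    ⊢A-substAg (repl ps) same a∉ b∉ (Repl ⊢ps)   = Repl (⊢Pres-substPres ps same a∉ b∉ ⊢ps)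

    ⊢Pres-substPres : ∀ {Δ} (ps : List (Pre n)) → SameType Δ → a ∉ bnPres ps → b ∉ bnPres ps →
                      All (_⊢P_ F Δ) ps → All (_⊢P_ F Δ) (substPres a b ps)
    ⊢Pres-substPres []       same a∉ b∉ []         = []
    ⊢Pres-substPres (p ∷ ps) same a∉ b∉ (⊢p ∷ ⊢ps) =
      ⊢P-substPre p same (∉-++⁻ˡ (bnPre p) a∉) (∉-++⁻ˡ (bnPre p) b∉) ⊢p
      ∷ ⊢Pres-substPres ps same (∉-++⁻ʳ (bnPre p) a∉) (∉-++⁻ʳ (bnPre p) b∉) ⊢ps

    ⊢P-substPre : ∀ {Δ} (p : Pre n) → SameType Δ → a ∉ bnPre p → b ∉ bnPre p →
                  _⊢P_ F Δ p → _⊢P_ F Δ (substPre a b p)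
    ⊢P-substPre (tau P) same a∉ b∉ (Tau ⊢P) = Tau (⊢NF-substNF P same a∉ b∉ ⊢P)
    ⊢P-substPre (out c d P) same a∉ b∉ (Out Δc Δd ⊢P) =
      Out (trans (lookupE-rn same c) Δc) (trans (lookupE-rn same d) Δd)
          (⊢NF-substNF P same a∉ b∉ ⊢P)
    ⊢P-substPre (inp c x P) same a∉ b∉ ⊢inp =
      subst (_⊢P_ F _) (sym (substPre-inp c x P (a∉ ∘ here ∘ sym)))
            (⊢inp-substNF same a∉ b∉ ⊢inp)

    ⊢inp-substNF : ∀ {Δ c x} {P : NF n} → SameType Δ → a ∉ x ∷ bnNF P → b ∉ x ∷ bnNF P →
                   _⊢P_ F Δ (inp c x P) → _⊢P_ F Δ (inp (rn a b c) x (substNF a b P))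
    ⊢inp-substNF {c = c} {x} {ν X ∙ As} same a∉ b∉ (In {τx = τx} Δc ⊢body migratable) =
      subst (λ Q → _⊢P_ F _ (inp (rn a b c) x Q))
            (sym (substNF-ν X As (∉-++⁻ˡ (dom X) (a∉ ∘ there))))
        (In (trans (lookupE-rn same c) Δc)
            (⊢ν-substAgs X As (SameType-++ ((x , τx) ∷ []) (λ { (here a≡x) → a∉ (here a≡x) })
                                                           (λ { (here b≡x) → b∉ (here b≡x) }) same)
                         (a∉ ∘ there) (b∉ ∘ there) ⊢body)
            (map₂ (migratable-substAgs c As same (∉-++⁻ʳ (dom X) (a∉ ∘ there))
                                       (∉-++⁻ˡ (dom X) (b∉ ∘ there)) (b∉ ∘ here ∘ sym))
                  migratable))

lemma8 : (F : Forest) (Γ : Env (Forest.n F)) (P : NF (Forest.n F))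
         (a b : Name) (τ : Ty (Forest.n F)) →
         IsNormalForm P →
         b ∉ bnNF P →
         lookupE Γ a ≡ just τ →
         lookupE Γ b ≡ just τ →
         _⊢NF_ F Γ P →
         _⊢NF_ F Γ (substNF a b P)
lemma8 F Γ P a b τ (_ , free∉bound) b∉ Γa Γb ⊢P with a ∈? bnNF P
... | yes a∈ = subst (_⊢NF_ F Γ) (sym (substNF-fresh P λ a∈fn → free∉bound a a∈fn a∈)) ⊢P
  where open Renaming a b
... | no a∉  = ⊢NF-substNF P (sameType (trans Γa (sym Γb))) a∉ b∉ ⊢P
  where open Renaming a b using (sameType)
        open Typing F a b
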